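{- Let $p\ge 2$ and let $G$ be a finite group generated by distinguished elements $t_0,\dots,t_{p-1}$, acting faithfully and transitively (on the right) on a finite set $Q$. Turn the corresponding Schreier graph into a $p$-automaton by choosing an initial state $q_0\in Q$ and a labeling map $\tau\colon Q\to\Delta$ satisfying: for every $h\in G$, if $\tau(q_0^{hg})=\tau(q_0^{g})$ for all $g\in G$, then $q_0^h=q_0$. Let $a$ be the $p$-automatic sequence produced. Then $a$ has global relations of all types, the monoid $G(a)$ is a group, there is a group isomorphism $\theta\colon G\to G(a)$ with $\theta(t_i)=t_i$ for all $i$, and there is a bijection $\varphi\colon Q\to N(a)$ with $\varphi(q_0)=a$ and $\varphi(q^{t_i})=\varphi(q)^{t_i}$ for all $q\in Q$ and all $i$ (so that $\Gamma(a)$ is identified with the graph underlying the automaton).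
   Context: Sequences are indexed from $n=1$. A $p$-automaton consists of a finite set of states, an initial state, a labeling map to a finite alphabet, and for each state and each $i\in\{0,\dots,p-1\}$ exactly one outgoing arrow labeled $i$; it produces $(a_n)_{n\ge1}$ where $a_n$ is the label of the state reached from the initial state by following the arrows labeled by the base-$p$ digits of $n$, read from right (least significant) to left. The Schreier graph of $G$ acting on $Q$ has vertex set $Q$ and an arrow labeled $i$ from $q$ to $q^{t_i}$. For integers $i,j\ge0$ with $j<p^i$, $a^{(i,j)}=(a_{p^in+j})_{n\ge1}$ and $N(a)=\{a^{(i,j)}\}$. A relation of a sequence $u$ is a pair $(i,j)\neq(0,0)$ with $i,j\ge 0$, $j<p^i$, $u^{(i,j)}=u$; $\operatorname{rel}(u)$ is the set of relations. The type of a relation $(i,j)$ is the leftmost digit of $j$ written in base $p$ padded with zeros on the left to exactly $i$ digits. A global relation for $a$ is an element of $\bigcap_{u\in N(a)}\operatorname{rel}(u)$; $a$ has global relations of all types if for each $r\in\{0,\dots,p-1\}$ there is a global relation of type $r$. For $u\in N(a)$, $u^{t_i}=(u_{pn+i})_{n\ge1}$; $G(a)$ is the monoid of self-maps of $N(a)$ generated by $t_0,\dots,t_{p-1}$ (maps written on the right, $u^{gh}=(u^g)^h$); it is a group when each $t_i$ is bijective. $\Gamma(a)$ is the labeled directed graph with vertex set $N(a)$ and an arrow labeled $i$ from $u$ to $u^{t_i}$, with distinguished vertex $a$. -}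

module Defs where

open import Level using (Level; _⊔_)
open import Data.Nat using (ℕ; zero; suc; _+_; _*_; _^_; _<_; _≤_; NonZero)
open import Data.Nat.DivMod using (_/_; _mod_)
open import Data.Nat.Properties using (m^n≢0)
open import Data.Fin using (Fin; toℕ)
open import Data.List using (List; []; _∷_; _++_)
open import Data.Bool using (Bool; true; false)
open import Data.Product using (Σ; _×_; _,_; ∃)
open import Relation.Binary.PropositionalEquality using (_≡_)
open import Relation.Nullary using (¬_)
open import Algebra.Bundles using (Group)

record RightAction {c ℓ} (G : Group c ℓ) (Q : Set) : Set (c ⊔ ℓ) where
  open Group G
  field
    act      : Q → Carrier → Q
    act-ε    : ∀ q → act q ε ≡ q
    act-∙    : ∀ q g h → act q (g ∙ h) ≡ act (act q g) h
    act-cong : ∀ q {g h} → g ≈ h → act q g ≡ act q h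

module _ {c ℓ} (G : Group c ℓ) where
  open Group G

  FiniteGroup : Set (c ⊔ ℓ)
  FiniteGroup = Σ ℕ λ n → Σ (Fin n → Carrier) λ f → ∀ g → Σ (Fin n) λ k → f k ≈ g

  evalWord : ∀ {p} → (Fin p → Carrier) → List (Fin p × Bool) → Carrier
  evalWord t [] = ε
  evalWord t ((i , false) ∷ w) = t i ∙ evalWord t w
  evalWord t ((i , true) ∷ w) = (t i) ⁻¹ ∙ evalWord t w

  GeneratedBy : ∀ {p} → (Fin p → Carrier) → Set (c ⊔ ℓ)
  GeneratedBy {p} t = ∀ g → Σ (List (Fin p × Bool)) λ w → evalWord t w ≈ g

  module _ {Q : Set} (A : RightAction G Q) where
    open RightAction A

    Faithful : Set (c ⊔ ℓ)
    Faithful = ∀ g h → (∀ q → act q g ≡ act q h) → g ≈ h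

    Transitive : Set c
    Transitive = ∀ q q′ → Σ Carrier λ g → act q g ≡ q′

-- Sequences indexed from 1: a sequence is a function ℕ → Δ whose value
-- at 0 is irrelevant; equality of sequences only looks at indices ≥ 1.

Seq : Set → Set
Seq Δ = ℕ → Δ

_≋_ : ∀ {Δ : Set} → Seq Δ → Seq Δ → Set
u ≋ v = ∀ n → u (suc n) ≡ v (suc n)

module _ (p : ℕ) .{{_ : NonZero p}} where

  -- Run of a p-automaton with transition δ, reading the base-p digits of n
  -- from least significant to most significant (no leading zeros).
  -- The first argument is fuel; fuel n suffices when p ≥ 2.
  run : ∀ {Q : Set} → (Q → Fin p → Q) → ℕ → Q → ℕ → Q
  run δ zero q n = q
  run δ (suc fuel) q zero = q
  run δ (suc fuel) q n@(suc _) = run δ fuel (δ q (n mod p)) (n / p)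

  autSeq : ∀ {Q Δ : Set} → (Q → Fin p → Q) → Q → (Q → Δ) → Seq Δ
  autSeq δ q₀ τ n = τ (run δ n q₀ n)

  module _ {Δ : Set} where

    sub : Seq Δ → ℕ → ℕ → Seq Δ
    sub u i j n = u (p ^ i * n + j)

    InN : Seq Δ → Seq Δ → Set
    InN a u = Σ ℕ λ i → Σ ℕ λ j → j < p ^ i × u ≋ sub a i j

    tAct : Fin p → Seq Δ → Seq Δ
    tAct i u n = u (p * n + toℕ i)

    -- action of a word t_{i₁} t_{i₂} ⋯ (maps on the right: first letter first)
    wordAct : List (Fin p) → Seq Δ → Seq Δ
    wordAct [] u = u
    wordAct (i ∷ w) u = wordAct w (tAct i u)

    -- two elements of G(a) (given by words) are equal as self-maps of N(a)
    SameOn : Seq Δ → List (Fin p) → List (Fin p) → Set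
    SameOn a w w′ = ∀ u → InN a u → wordAct w u ≋ wordAct w′ u

    GaIsGroup : Seq Δ → Set
    GaIsGroup a = ∀ w → Σ (List (Fin p)) λ w′ → SameOn a (w ++ w′) [] × SameOn a (w′ ++ w) []

    IsRelation : Seq Δ → ℕ → ℕ → Set
    IsRelation u i j = ¬ (i ≡ 0 × j ≡ 0) × j < p ^ i × sub u i j ≋ u

    -- type of (i,j): leftmost digit of j padded to exactly i digits (i ≥ 1)
    HasType : ℕ → ℕ → Fin p → Set
    HasType i j r = Σ ℕ λ i′ → i ≡ suc i′ × (_/_ j (p ^ i′) {{m^n≢0 p i′}}) ≡ toℕ r

    GlobalRelation : Seq Δ → ℕ → ℕ → Set
    GlobalRelation a i j = ∀ u → InN a u → IsRelation u i j

    GlobalRelationsOfAllTypes : Seq Δ → Set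
    GlobalRelationsOfAllTypes a =
      ∀ (r : Fin p) → Σ ℕ λ i → Σ ℕ λ j → HasType i j r × GlobalRelation a i j

-- The inverse of an element of a finite group is one of its powers, so every element of G is the
-- value of a positive word in the generators. Reading the base-p digits of n from a state q and
-- labelling with τ gives a sequence φ q with φ q₀ = a and (φ q)^{t_i} = φ (q^{t_i}); as Q is a
-- single orbit, N(a) is the image of φ. Equal sequences φ q and φ q′ carry the labels τ (q^z) and
-- τ (q′^z) at the same places for every z ∈ G, so the hypothesis on τ makes φ injective. Through
-- the bijection φ a word acts on N(a) as its value in G acts on Q; faithfulness turns this into
-- the isomorphism G ≅ G(a), and a positive word for t_r⁻¹ followed by t_r acts trivially, which
-- gives a global relation of type r.
module Submission where

open import Defs
open import Algebra.Bundles using (Group)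
import Algebra.Properties.Group as GroupProperties
import Algebra.Properties.Monoid.Mult as MonoidMultiplication
open import Data.Bool using (Bool; true; false)
open import Data.Fin using (Fin; toℕ)
open import Data.Fin.Properties using (toℕ-fromℕ<; toℕ-injective; toℕ<n; pigeonhole)
open import Data.List using (List; []; _∷_; _++_; _∷ʳ_; length; foldl; replicate)
open import Data.List.Properties using (length-++)
open import Data.Nat using (ℕ; zero; suc; _+_; _*_; _^_; _∸_; _<_; _≤_; _>_; s≤s; z<s; NonZero)
open import Data.Nat.DivMod
open import Data.Nat.Divisibility using (m∣m*n)
open import Data.Nat.Properties
open import Data.Nat.Tactic.RingSolver using (solve-∀)
open import Data.Product using (Σ; _×_; _,_; proj₁; proj₂)
import Relation.Binary.Reasoning.Setoid
open import Relation.Binary.PropositionalEquality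
  using (_≡_; refl; sym; trans; cong; cong₂; subst; module ≡-Reasoning)

[n*k+m]%n≡m : ∀ n .{{_ : NonZero n}} k {m} → m < n → (n * k + m) % n ≡ m
[n*k+m]%n≡m n k {m} m<n = begin
  (n * k + m) % n ≡⟨ cong (_% n) (trans (+-comm (n * k) m) (cong (m +_) (*-comm n k))) ⟩
  (m + k * n) % n ≡⟨ [m+kn]%n≡m%n m k n ⟩
  m % n           ≡⟨ m<n⇒m%n≡m m<n ⟩
  m               ∎
  where open ≡-Reasoning

[n*k+m]/n≡k : ∀ n .{{_ : NonZero n}} k {m} → m < n → (n * k + m) / n ≡ k
[n*k+m]/n≡k n k {m} m<n = begin
  (n * k + m) / n   ≡⟨ cong (_/ n) (+-comm (n * k) m) ⟩
  (m + n * k) / n   ≡⟨ +-distrib-/-∣ʳ m (m∣m*n k) ⟩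
  m / n + n * k / n ≡⟨ cong₂ _+_ (m<n⇒m/n≡0 m<n) (trans (cong (_/ n) (*-comm n k)) (m*n/n≡m k n)) ⟩
  k                 ∎
  where open ≡-Reasoning

m*[1+n]+o>0 : ∀ m .{{_ : NonZero m}} n o → m * suc n + o > 0
m*[1+n]+o>0 (suc m) n o = z<s

module SequenceOperations (p : ℕ) .{{_ : NonZero p}} {Δ : Set} where

  ≋-apply : ∀ {u v : Seq Δ} → u ≋ v → ∀ {N} → N > 0 → u N ≡ v N
  ≋-apply u≋v {suc N} _ = u≋v N

  tAct-cong : ∀ i {u v : Seq Δ} → u ≋ v → tAct p i u ≋ tAct p i v
  tAct-cong i {u} {v} u≋v n = ≋-apply {u} {v} u≋v (m*[1+n]+o>0 p n (toℕ i))

  wordAct-cong : ∀ w {u v : Seq Δ} → u ≋ v → wordAct p w u ≋ wordAct p w v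
  wordAct-cong []      u≋v = u≋v
  wordAct-cong (i ∷ w) {u} {v} u≋v = wordAct-cong w (tAct-cong i {u} {v} u≋v)

  sub-cong : ∀ i j {u v : Seq Δ} → u ≋ v → sub p u i j ≋ sub p v i j
  sub-cong i j {u} {v} u≋v n = ≋-apply {u} {v} u≋v (m*[1+n]+o>0 (p ^ i) {{m^n≢0 p i}} n j)

module Numerals (p : ℕ) .{{_ : NonZero p}} where

  value : List (Fin p) → ℕ
  value []      = 0
  value (d ∷ w) = p * value w + toℕ d

  value<p^length : ∀ w → value w < p ^ length w
  value<p^length []      = z<s
  value<p^length (d ∷ w) = begin-strict
    p * value w + toℕ d <⟨ +-monoʳ-< (p * value w) (toℕ<n d) ⟩
    p * value w + p     ≡⟨ +-comm (p * value w) p ⟩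
    p + p * value w     ≡⟨ *-suc p (value w) ⟨
    p * suc (value w)   ≤⟨ *-monoʳ-≤ p (value<p^length w) ⟩
    p * p ^ length w    ∎
    where open ≤-Reasoning

  digitsOf : ∀ i j → j < p ^ i → Σ (List (Fin p)) λ w → length w ≡ i × value w ≡ j
  digitsOf zero    zero    _ = [] , refl , refl
  digitsOf zero    (suc j) (s≤s ())
  digitsOf (suc i) j j<p^[1+i]
    with digitsOf i (j / p) (m<n*o⇒m/o<n (subst (j <_) (*-comm p (p ^ i)) j<p^[1+i]))
  ... | w , refl , value-w≡j/p = j mod p ∷ w , refl , (begin
    p * value w + toℕ (j mod p) ≡⟨ cong₂ _+_ (cong (p *_) value-w≡j/p) (toℕ-fromℕ< _) ⟩
    p * (j / p) + j % p         ≡⟨ +-comm (p * (j / p)) (j % p) ⟩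
    j % p + p * (j / p)         ≡⟨ cong (j % p +_) (*-comm p (j / p)) ⟩
    j % p + j / p * p           ≡⟨ m≡m%n+[m/n]*n j p ⟨
    j                           ∎)
    where open ≡-Reasoning

  [p*n+d]mod-p≡d : ∀ n d → (p * n + toℕ d) mod p ≡ d
  [p*n+d]mod-p≡d n d = toℕ-injective (trans (toℕ-fromℕ< _) ([n*k+m]%n≡m p n (toℕ<n d)))

  value-∷ʳ : ∀ w r → value (w ∷ʳ r) ≡ p ^ length w * toℕ r + value w
  value-∷ʳ []      r = trans (cong (_+ toℕ r) (*-zeroʳ p))
                             (sym (trans (+-identityʳ (1 * toℕ r)) (*-identityˡ (toℕ r))))
  value-∷ʳ (d ∷ w) r = trans (cong (λ v → p * v + toℕ d) (value-∷ʳ w r))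
                             (distribute p (p ^ length w) (toℕ r) (value w) (toℕ d))
    where
    distribute : ∀ p P r v d → p * (P * r + v) + d ≡ p * P * r + (p * v + d)
    distribute = solve-∀

  value-∷ʳ-leadingDigit : ∀ w r → _/_ (value (w ∷ʳ r)) (p ^ length w) {{m^n≢0 p (length w)}} ≡ toℕ r
  value-∷ʳ-leadingDigit w r =
    trans (cong (λ v → v / p ^ length w) (value-∷ʳ w r))
          ([n*k+m]/n≡k (p ^ length w) (toℕ r) (value<p^length w))
    where instance _ = m^n≢0 p (length w)

module Automaton (p : ℕ) .{{_ : NonZero p}} (2≤p : 2 ≤ p)
                 {Q Δ : Set} (δ : Q → Fin p → Q) (τ : Q → Δ) where
  open Numerals p
  open SequenceOperations p

  reach : Q → ℕ → Q
  reach q n = run p δ n q n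

  run-0 : ∀ f q → run p δ f q 0 ≡ q
  run-0 zero    q = refl
  run-0 (suc f) q = refl

  -- Each step divides the input by p ≥ 2, so fuel n suffices for input n.
  run-fuel-irrelevant : ∀ {f f′} q n → n ≤ f → n ≤ f′ → run p δ f q n ≡ run p δ f′ q n
  run-fuel-irrelevant {f} {f′} q zero _ _ = trans (run-0 f q) (sym (run-0 f′ q))
  run-fuel-irrelevant {suc f} {suc f′} q (suc n) (s≤s n≤f) (s≤s n≤f′) =
    run-fuel-irrelevant _ _ (≤-trans [1+n]/p≤n n≤f) (≤-trans [1+n]/p≤n n≤f′)
    where
    [1+n]/p≤n : suc n / p ≤ n
    [1+n]/p≤n = ≤-pred (m/n<m (suc n) p 2≤p)

  reach-unfold : ∀ q N → N > 0 → reach q N ≡ reach (δ q (N mod p)) (N / p)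
  reach-unfold q (suc N) _ = run-fuel-irrelevant _ _ (≤-pred (m/n<m (suc N) p 2≤p)) ≤-refl

  reach-step : ∀ q d n → n > 0 → reach q (p * n + toℕ d) ≡ reach (δ q d) n
  reach-step q d (suc n) _ =
    trans (reach-unfold q _ (m*[1+n]+o>0 p n (toℕ d)))
          (cong₂ reach (cong (δ q) ([p*n+d]mod-p≡d (suc n) d)) ([n*k+m]/n≡k p (suc n) (toℕ<n d)))

  reach-digits : ∀ w q n → reach q (p ^ length w * suc n + value w) ≡ reach (foldl δ q w) (suc n)
  reach-digits []      q n = cong (reach q) (trans (+-identityʳ (1 * suc n)) (*-identityˡ (suc n)))
  reach-digits (d ∷ w) q n = begin
    reach q (p * P * suc n + (p * value w + toℕ d)) ≡⟨ cong (reach q) (regroup p P (suc n) (value w) (toℕ d)) ⟩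
    reach q (p * (P * suc n + value w) + toℕ d)     ≡⟨ reach-step q d _ (m*[1+n]+o>0 P {{m^n≢0 p (length w)}} n (value w)) ⟩
    reach (δ q d) (P * suc n + value w)             ≡⟨ reach-digits w (δ q d) n ⟩
    reach (foldl δ (δ q d) w) (suc n)               ∎
    where
    open ≡-Reasoning
    P = p ^ length w
    regroup : ∀ p P N v d → p * P * N + (p * v + d) ≡ p * (P * N + v) + d
    regroup = solve-∀

  stateSeq : Q → Seq Δ
  stateSeq q n = τ (reach q n)

  stateSeq-≡ : ∀ {q q′} → q ≡ q′ → stateSeq q ≋ stateSeq q′
  stateSeq-≡ q≡q′ n = cong (λ q → stateSeq q (suc n)) q≡q′

  tAct-stateSeq : ∀ i q → tAct p i (stateSeq q) ≋ stateSeq (δ q i)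
  tAct-stateSeq i q n = cong τ (reach-step q i (suc n) z<s)

  wordAct-stateSeq : ∀ w q → wordAct p w (stateSeq q) ≋ stateSeq (foldl δ q w)
  wordAct-stateSeq []      q n = refl
  wordAct-stateSeq (i ∷ w) q n =
    trans (wordAct-cong w (tAct-stateSeq i q) n) (wordAct-stateSeq w (δ q i) n)

  sub-stateSeq : ∀ w q → sub p (stateSeq q) (length w) (value w) ≋ stateSeq (foldl δ q w)
  sub-stateSeq w q n = cong τ (reach-digits w q n)

  -- The input p^|w| + value w is w followed by the leading digit 1.
  stateSeq-≋⇒labels : ∀ {q q′} → stateSeq q ≋ stateSeq q′ → ∀ w →
                      τ (δ (foldl δ q w) (1 mod p)) ≡ τ (δ (foldl δ q′ w) (1 mod p))
  stateSeq-≋⇒labels {q} {q′} q≋q′ w = begin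
    τ (δ (foldl δ q w) (1 mod p))           ≡⟨ cong τ (reach-digits w q 0) ⟨
    stateSeq q (p ^ length w * 1 + value w)  ≡⟨ ≋-apply {u = stateSeq q} {v = stateSeq q′} q≋q′ (m*[1+n]+o>0 (p ^ length w) {{m^n≢0 p (length w)}} 0 (value w)) ⟩
    stateSeq q′ (p ^ length w * 1 + value w) ≡⟨ cong τ (reach-digits w q′ 0) ⟩
    τ (δ (foldl δ q′ w) (1 mod p))          ∎
    where open ≡-Reasoning

  module Orbit (q₀ : Q) where

    InN⇒reachable : ∀ u → InN p (stateSeq q₀) u → Σ (List (Fin p)) λ w → u ≋ stateSeq (foldl δ q₀ w)
    InN⇒reachable u (i , j , j<p^i , u≋sub) with digitsOf i j j<p^i
    ... | w , refl , refl = w , λ n → trans (u≋sub n) (sub-stateSeq w q₀ n)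

    reachable⇒InN : ∀ w → InN p (stateSeq q₀) (stateSeq (foldl δ q₀ w))
    reachable⇒InN w = length w , value w , value<p^length w , λ n → sym (sub-stateSeq w q₀ n)

    SameOn-fromStates : ∀ w w′ → (∀ q → foldl δ q w ≡ foldl δ q w′) → SameOn p (stateSeq q₀) w w′
    SameOn-fromStates w w′ same u u∈N n with InN⇒reachable u u∈N
    ... | v , u≋ = begin
      wordAct p w u (suc n)                  ≡⟨ wordAct-cong w {u = u} {v = stateSeq q} u≋ n ⟩
      wordAct p w (stateSeq q) (suc n)       ≡⟨ wordAct-stateSeq w q n ⟩
      stateSeq (foldl δ q w) (suc n)         ≡⟨ stateSeq-≡ (same q) n ⟩
      stateSeq (foldl δ q w′) (suc n)        ≡⟨ wordAct-stateSeq w′ q n ⟨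
      wordAct p w′ (stateSeq q) (suc n)      ≡⟨ wordAct-cong w′ {u = u} {v = stateSeq q} u≋ n ⟨
      wordAct p w′ u (suc n)                 ∎
      where
      open ≡-Reasoning
      q = foldl δ q₀ v

    loop⇒globalRelation : ∀ w → length w > 0 → (∀ q → foldl δ q w ≡ q) →
                          GlobalRelation p (stateSeq q₀) (length w) (value w)
    loop⇒globalRelation w |w|>0 loop u u∈N with InN⇒reachable u u∈N
    ... | v , u≋ = (λ (|w|≡0 , _) → <-irrefl (sym |w|≡0) |w|>0) , value<p^length w , λ n → begin
      sub p u (length w) (value w) (suc n)                   ≡⟨ sub-cong (length w) (value w) {u = u} {v = stateSeq q} u≋ n ⟩
      sub p (stateSeq q) (length w) (value w) (suc n)        ≡⟨ sub-stateSeq w q n ⟩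
      stateSeq (foldl δ q w) (suc n)                         ≡⟨ stateSeq-≡ (loop q) n ⟩
      stateSeq q (suc n)                                     ≡⟨ u≋ n ⟨
      u (suc n)                                              ∎
      where
      open ≡-Reasoning
      q = foldl δ q₀ v

module PositiveWords {c ℓ} (G : Group c ℓ) where
  open Group G renaming (refl to ≈-refl; sym to ≈-sym; trans to ≈-trans)
  open GroupProperties G using (inverseʳ-unique; ∙-cancelʳ)
  open MonoidMultiplication monoid using () renaming (_×_ to _·_; ×-homo-+ to ·-homo-+)
  open import Relation.Binary.Reasoning.Setoid setoid

  evalPositive : ∀ {p} → (Fin p → Carrier) → List (Fin p) → Carrier
  evalPositive t []      = ε
  evalPositive t (i ∷ w) = t i ∙ evalPositive t w

  evalPositive-++ : ∀ {p} (t : Fin p → Carrier) u v →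
                    evalPositive t (u ++ v) ≈ evalPositive t u ∙ evalPositive t v
  evalPositive-++ t []      v = ≈-sym (identityˡ _)
  evalPositive-++ t (i ∷ u) v = ≈-trans (∙-congˡ (evalPositive-++ t u v)) (≈-sym (assoc _ _ _))

  evalPositive-replicate : ∀ {p} (t : Fin p → Carrier) n i → evalPositive t (replicate n i) ≈ n · t i
  evalPositive-replicate t zero    i = ≈-refl
  evalPositive-replicate t (suc n) i = ∙-congˡ (evalPositive-replicate t n i)

  -- Pigeonhole: two of the powers 0·g, …, n·g coincide, where n bounds the size of G.
  inverse-isPower : FiniteGroup G → ∀ g → Σ ℕ λ d → d · g ≈ g ⁻¹
  inverse-isPower (n , f , index) g
    with a , b , a<b , sameIndex ← pigeonhole (n<1+n n) (λ i → proj₁ (index (toℕ i · g)))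
    = d , inverseʳ-unique g (d · g) g∙d·g≈ε
    where
    d = toℕ b ∸ suc (toℕ a)
    powers-agree : toℕ a · g ≈ toℕ b · g
    powers-agree = begin
      toℕ a · g                          ≈⟨ proj₂ (index (toℕ a · g)) ⟨
      f (proj₁ (index (toℕ a · g)))      ≡⟨ cong f sameIndex ⟩
      f (proj₁ (index (toℕ b · g)))      ≈⟨ proj₂ (index (toℕ b · g)) ⟩
      toℕ b · g                          ∎
    g∙d·g≈ε : g ∙ d · g ≈ ε
    g∙d·g≈ε = ∙-cancelʳ (toℕ a · g) _ _ (begin
      (g ∙ d · g) ∙ toℕ a · g ≈⟨ ·-homo-+ g (suc d) (toℕ a) ⟨
      (suc d + toℕ a) · g     ≡⟨ cong (_· g) (trans (sym (+-suc d (toℕ a))) (m∸n+n≡m a<b)) ⟩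
      toℕ b · g               ≈⟨ powers-agree ⟨
      toℕ a · g               ≈⟨ identityˡ (toℕ a · g) ⟨
      ε ∙ toℕ a · g           ∎)

  module _ {p} (t : Fin p → Carrier) (finite : FiniteGroup G) where

    positive : List (Fin p × Bool) → List (Fin p)
    positive []               = []
    positive ((i , false) ∷ w) = i ∷ positive w
    positive ((i , true) ∷ w)  = replicate (proj₁ (inverse-isPower finite (t i))) i ++ positive w

    evalPositive-positive : ∀ w → evalPositive t (positive w) ≈ evalWord G t w
    evalPositive-positive []               = ≈-refl
    evalPositive-positive ((i , false) ∷ w) = ∙-congˡ (evalPositive-positive w)
    evalPositive-positive ((i , true) ∷ w)  = begin
      evalPositive t (replicate d i ++ positive w)              ≈⟨ evalPositive-++ t (replicate d i) (positive w) ⟩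
      evalPositive t (replicate d i) ∙ evalPositive t (positive w) ≈⟨ ∙-cong (evalPositive-replicate t d i) (evalPositive-positive w) ⟩
      d · t i ∙ evalWord G t w                                   ≈⟨ ∙-congʳ (proj₂ (inverse-isPower finite (t i))) ⟩
      t i ⁻¹ ∙ evalWord G t w                                    ∎
      where d = proj₁ (inverse-isPower finite (t i))

    positiveWord : GeneratedBy G t → ∀ g → Σ (List (Fin p)) λ w → evalPositive t w ≈ g
    positiveWord generated g =
      positive (proj₁ (generated g)) ,
      ≈-trans (evalPositive-positive (proj₁ (generated g))) (proj₂ (generated g))

module Action {c ℓ} (G : Group c ℓ) {Q : Set} (A : RightAction G Q) where
  open Group G using (Carrier; _∙_; _⁻¹; assoc)
  open RightAction A
  open GroupProperties G using (//-rightDividesˡ; \\-leftDividesˡ)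
  open PositiveWords G using (evalPositive)

  act-foldl : ∀ {p} (t : Fin p → Carrier) q w →
              foldl (λ q i → act q (t i)) q w ≡ act q (evalPositive t w)
  act-foldl t q []      = sym (act-ε q)
  act-foldl t q (i ∷ w) = trans (act-foldl t (act q (t i)) w) (sym (act-∙ q (t i) (evalPositive t w)))

  act-//ʳ : ∀ q z g → act (act q (z ∙ g ⁻¹)) g ≡ act q z
  act-//ʳ q z g = trans (sym (act-∙ q (z ∙ g ⁻¹) g)) (act-cong q (//-rightDividesˡ g z))

  -- For q = q₀^x and q′ = q₀^y, the element h = x y⁻¹ satisfies τ(q₀^{hg}) = τ(q₀^g) for all g.
  labels-separate : Transitive G A → ∀ {Δ : Set} (τ : Q → Δ) q₀ →
    (∀ h → (∀ g → τ (act q₀ (h ∙ g)) ≡ τ (act q₀ g)) → act q₀ h ≡ q₀) →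
    ∀ q q′ → (∀ z → τ (act q z) ≡ τ (act q′ z)) → q ≡ q′
  labels-separate transitive τ q₀ separates q q′ same with transitive q₀ q | transitive q₀ q′
  ... | x , q₀x≡q | y , q₀y≡q′ = begin
    q                           ≡⟨ q₀x≡q ⟨
    act q₀ x                    ≡⟨ act-//ʳ q₀ x y ⟨
    act (act q₀ (x ∙ y ⁻¹)) y   ≡⟨ cong (λ r → act r y) (separates (x ∙ y ⁻¹) fixes-labels) ⟩
    act q₀ y                    ≡⟨ q₀y≡q′ ⟩
    q′                          ∎
    where
    open ≡-Reasoning
    act-from : ∀ {r z} → act q₀ z ≡ r → ∀ g → act q₀ (z ∙ g) ≡ act r g
    act-from q₀z≡r g = trans (act-∙ q₀ _ g) (cong (λ r → act r g) q₀z≡r)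
    fixes-labels : ∀ g → τ (act q₀ ((x ∙ y ⁻¹) ∙ g)) ≡ τ (act q₀ g)
    fixes-labels g = begin
      τ (act q₀ ((x ∙ y ⁻¹) ∙ g))  ≡⟨ cong τ (trans (act-cong q₀ (assoc x (y ⁻¹) g)) (act-from q₀x≡q (y ⁻¹ ∙ g))) ⟩
      τ (act q (y ⁻¹ ∙ g))         ≡⟨ same (y ⁻¹ ∙ g) ⟩
      τ (act q′ (y ⁻¹ ∙ g))        ≡⟨ cong τ (trans (sym (act-from q₀y≡q′ (y ⁻¹ ∙ g))) (act-cong q₀ (\\-leftDividesˡ y g))) ⟩
      τ (act q₀ g)                 ∎

module SchreierAutomaton {c ℓ} (p : ℕ) .{{_ : NonZero p}} (2≤p : 2 ≤ p)
  (G : Group c ℓ) (finite : FiniteGroup G) (t : Fin p → Group.Carrier G) (generated : GeneratedBy G t)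
  {Q : Set} (A : RightAction G Q) (faithful : Faithful G A) (transitive : Transitive G A)
  {Δ : Set} (q₀ : Q) (τ : Q → Δ)
  (separates : ∀ h → (∀ g → τ (RightAction.act A q₀ (Group._∙_ G h g)) ≡ τ (RightAction.act A q₀ g))
               → RightAction.act A q₀ h ≡ q₀) where

  open Group G
    using (Carrier; _≈_; _∙_; _⁻¹; ε; setoid; inverseˡ; inverseʳ; identityʳ; ∙-cong; ∙-congˡ; ∙-congʳ)
    renaming (sym to ≈-sym; trans to ≈-trans)
  open RightAction A
  open PositiveWords G
  open Action G A
  open Numerals p

  δ : Q → Fin p → Q
  δ q i = act q (t i)

  open Automaton p 2≤p δ τ public
  open Orbit q₀

  a : Seq Δ
  a = stateSeq q₀

  θ : Carrier → List (Fin p)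
  θ g = proj₁ (positiveWord t finite generated g)

  evalPositive-θ : ∀ g → evalPositive t (θ g) ≈ g
  evalPositive-θ g = proj₂ (positiveWord t finite generated g)

  foldl-θ : ∀ q g → foldl δ q (θ g) ≡ act q g
  foldl-θ q g = trans (act-foldl t q (θ g)) (act-cong q (evalPositive-θ g))

  SameOn-fromValues : ∀ w w′ → evalPositive t w ≈ evalPositive t w′ → SameOn p a w w′
  SameOn-fromValues w w′ w≈w′ = SameOn-fromStates w w′ λ q →
    trans (act-foldl t q w) (trans (act-cong q w≈w′) (sym (act-foldl t q w′)))

  stateSeq-InN : ∀ q → InN p a (stateSeq q)
  stateSeq-InN q with x , q₀x≡q ← transitive q₀ q =
    subst (λ r → InN p a (stateSeq r)) (trans (foldl-θ q₀ x) q₀x≡q) (reachable⇒InN (θ x))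

  InN⇒stateSeq : ∀ u → InN p a u → Σ Q λ q → stateSeq q ≋ u
  InN⇒stateSeq u u∈N with w , u≋ ← InN⇒reachable u u∈N = foldl δ q₀ w , λ n → sym (u≋ n)

  stateSeq-injective : ∀ q q′ → stateSeq q ≋ stateSeq q′ → q ≡ q′
  stateSeq-injective q q′ q≋q′ = labels-separate transitive τ q₀ separates q q′ λ z →
    trans (sym (label-after q z)) (trans (stateSeq-≋⇒labels q≋q′ (θ (z ∙ t (1 mod p) ⁻¹))) (label-after q′ z))
    where
    label-after : ∀ r z → τ (δ (foldl δ r (θ (z ∙ t (1 mod p) ⁻¹))) (1 mod p)) ≡ τ (act r z)
    label-after r z = cong τ (trans (cong (λ s → act s (t (1 mod p))) (foldl-θ r (z ∙ t (1 mod p) ⁻¹)))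
                                    (act-//ʳ r z (t (1 mod p))))

  Ga-isGroup : GaIsGroup p a
  Ga-isGroup w = θ (g ⁻¹) ,
    SameOn-fromValues (w ++ θ (g ⁻¹)) [] (begin
      evalPositive t (w ++ θ (g ⁻¹))             ≈⟨ evalPositive-++ t w (θ (g ⁻¹)) ⟩
      g ∙ evalPositive t (θ (g ⁻¹))              ≈⟨ ∙-congˡ (evalPositive-θ (g ⁻¹)) ⟩
      g ∙ g ⁻¹                                   ≈⟨ inverseʳ g ⟩
      ε                                          ∎) ,
    SameOn-fromValues (θ (g ⁻¹) ++ w) [] (begin
      evalPositive t (θ (g ⁻¹) ++ w)             ≈⟨ evalPositive-++ t (θ (g ⁻¹)) w ⟩
      evalPositive t (θ (g ⁻¹)) ∙ g              ≈⟨ ∙-congʳ (evalPositive-θ (g ⁻¹)) ⟩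
      g ⁻¹ ∙ g                                   ≈⟨ inverseˡ g ⟩
      ε                                          ∎)
    where
    open Relation.Binary.Reasoning.Setoid setoid
    g = evalPositive t w

  θ-cong : ∀ g h → g ≈ h → SameOn p a (θ g) (θ h)
  θ-cong g h g≈h = SameOn-fromValues (θ g) (θ h)
    (≈-trans (evalPositive-θ g) (≈-trans g≈h (≈-sym (evalPositive-θ h))))

  θ-homomorphic : ∀ g h → SameOn p a (θ (g ∙ h)) (θ g ++ θ h)
  θ-homomorphic g h = SameOn-fromValues (θ (g ∙ h)) (θ g ++ θ h)
    (≈-trans (evalPositive-θ (g ∙ h))
      (≈-sym (≈-trans (evalPositive-++ t (θ g) (θ h)) (∙-cong (evalPositive-θ g) (evalPositive-θ h)))))

  θ-generator : ∀ i → SameOn p a (θ (t i)) (i ∷ [])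
  θ-generator i = SameOn-fromValues (θ (t i)) (i ∷ []) (≈-trans (evalPositive-θ (t i)) (≈-sym (identityʳ (t i))))

  θ-surjective : ∀ w → Σ Carrier λ g → SameOn p a (θ g) w
  θ-surjective w = evalPositive t w , SameOn-fromValues (θ (evalPositive t w)) w (evalPositive-θ (evalPositive t w))

  θ-injective : ∀ g h → SameOn p a (θ g) (θ h) → g ≈ h
  θ-injective g h same = faithful g h λ q → stateSeq-injective _ _ λ n → begin
    stateSeq (act q g) (suc n)               ≡⟨ stateSeq-≡ (foldl-θ q g) n ⟨
    stateSeq (foldl δ q (θ g)) (suc n)       ≡⟨ wordAct-stateSeq (θ g) q n ⟨
    wordAct p (θ g) (stateSeq q) (suc n)     ≡⟨ same (stateSeq q) (stateSeq-InN q) n ⟩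
    wordAct p (θ h) (stateSeq q) (suc n)     ≡⟨ wordAct-stateSeq (θ h) q n ⟩
    stateSeq (foldl δ q (θ h)) (suc n)       ≡⟨ stateSeq-≡ (foldl-θ q h) n ⟩
    stateSeq (act q h) (suc n)               ∎
    where open ≡-Reasoning

  globalRelationsOfAllTypes : GlobalRelationsOfAllTypes p a
  globalRelationsOfAllTypes r =
    length w , value w , (length u , |w|≡1+|u| , value-∷ʳ-leadingDigit u r) ,
    loop⇒globalRelation w (subst (_> 0) (sym |w|≡1+|u|) z<s) loop
    where
    u = θ (t r ⁻¹)
    w = u ∷ʳ r
    |w|≡1+|u| : length w ≡ suc (length u)
    |w|≡1+|u| = trans (length-++ u) (+-comm (length u) 1)
    w≈ε : evalPositive t w ≈ ε
    w≈ε = begin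
      evalPositive t (u ++ r ∷ [])           ≈⟨ evalPositive-++ t u (r ∷ []) ⟩
      evalPositive t u ∙ (t r ∙ ε)           ≈⟨ ∙-cong (evalPositive-θ (t r ⁻¹)) (identityʳ (t r)) ⟩
      t r ⁻¹ ∙ t r                           ≈⟨ inverseˡ (t r) ⟩
      ε                                      ∎
      where open Relation.Binary.Reasoning.Setoid setoid
    loop : ∀ q → foldl δ q w ≡ q
    loop q = trans (act-foldl t q w) (trans (act-cong q w≈ε) (act-ε q))

mainTheorem4 : ∀ {c ℓ} (p : ℕ) .{{_ : NonZero p}} → 2 ≤ p →
  (G : Group c ℓ) → FiniteGroup G →
  (t : Fin p → Group.Carrier G) → GeneratedBy G t →
  (m : ℕ) (A : RightAction G (Fin m)) → Faithful G A → Transitive G A →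
  (k : ℕ) (q₀ : Fin m) (τ : Fin m → Fin k) →
  (∀ h → (∀ g → τ (RightAction.act A q₀ (Group._∙_ G h g)) ≡ τ (RightAction.act A q₀ g))
       → RightAction.act A q₀ h ≡ q₀) →
  let δ = λ q i → RightAction.act A q (t i)
      a = autSeq p δ q₀ τ
  in GlobalRelationsOfAllTypes p a
     × GaIsGroup p a
     × Σ (Group.Carrier G → List (Fin p)) (λ θ →
          (∀ g h → Group._≈_ G g h → SameOn p a (θ g) (θ h))
          × (∀ g h → SameOn p a (θ (Group._∙_ G g h)) (θ g ++ θ h))
          × (∀ i → SameOn p a (θ (t i)) (i ∷ []))
          × (∀ g h → SameOn p a (θ g) (θ h) → Group._≈_ G g h)
          × (∀ w → Σ (Group.Carrier G) λ g → SameOn p a (θ g) w))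
     × Σ (Fin m → Seq (Fin k)) (λ φ →
          (∀ q → InN p a (φ q))
          × φ q₀ ≋ a
          × (∀ q i → φ (δ q i) ≋ tAct p i (φ q))
          × (∀ q q′ → φ q ≋ φ q′ → q ≡ q′)
          × (∀ u → InN p a u → Σ (Fin m) λ q → φ q ≋ u))
mainTheorem4 p 2≤p G finite t generated m A faithful transitive k q₀ τ separates =
  globalRelationsOfAllTypes ,
  Ga-isGroup ,
  (θ , θ-cong , θ-homomorphic , θ-generator , θ-injective , θ-surjective) ,
  (stateSeq , stateSeq-InN , (λ n → refl) , (λ q i n → sym (tAct-stateSeq i q n)) ,
   stateSeq-injective , InN⇒stateSeq)
  where open SchreierAutomaton p 2≤p G finite t generated A faithful transitive q₀ τ separates
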